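{- Let $P$ be a non-empty set and $\mathcal{L}$ a set of formulae with semantic function $[\![\cdot]\!]:\mathcal{L}\to\mathcal{P}(P)$ such that $\mathcal{L}(p)\neq\emptyset$ for every $p\in P$. Suppose $\mathcal{L}$ features the Boolean connective $\wedge$ and: (i) $\mathcal{L}$ is finitely characterized by $\mathcal{B}$ for some monotonic $\mathcal{B}$; (ii) for each $p\in P$ having a characteristic formula $\chi(p)$, there is a formula $\bar\chi(p)\in\mathcal{L}$ such that either $[\![\bar\chi(p)]\!]=P\setminus[\![\chi(p)]\!]$, or $p\notin[\![\bar\chi(p)]\!]$ and $\{q\in P\mid\mathcal{L}(q)\not\subseteq\mathcal{L}(p)\}\subseteq[\![\bar\chi(p)]\!]$. Then $\mathcal{L}$ is decomposable.
   Context: For $p\in P$, $\mathcal{L}(p)=\{\phi\in\mathcal{L}\mid p\in[\![\phi]\!]\}$. "$\mathcal{L}$ features $\wedge$" means that for all $\phi,\psi\in\mathcal{L}$ there is $\phi\wedge\psi\in\mathcal{L}$ with $[\![\phi\wedge\psi]\!]=[\![\phi]\!]\cap[\![\psi]\!]$. A formula is consistent iff its denotation is non-empty. A formula $\chi(p)$ is characteristic for $p$ iff for all $q\in P$: $q\in[\![\chi(p)]\!]$ iff $\mathcal{L}(p)\subseteq\mathcal{L}(q)$. $\mathcal{L}$ is characterized by $\mathcal{B}:P\to\mathcal{P}(\mathcal{L})$ iff for each $p\in P$: $\emptyset\subsetneq\mathcal{B}(p)\subseteq\mathcal{L}(p)$ and for each $\phi\in\mathcal{L}(p)$, $\bigcap_{\psi\in\mathcal{B}(p)}[\![\psi]\!]\subseteq[\![\phi]\!]$;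 finitely characterized if moreover each $\mathcal{B}(p)$ is finite; $\mathcal{B}$ is monotonic iff $\mathcal{L}(p)\subseteq\mathcal{L}(q)$ implies $\mathcal{B}(p)\subseteq\mathcal{B}(q)$. A formula $\phi$ is decomposable iff $[\![\phi]\!]=[\![\chi(p)]\!]\cup[\![\psi_p]\!]$ for some $p\in P$ having a characteristic formula $\chi(p)$ and some $\psi_p\in\mathcal{L}$ with $p\notin[\![\psi_p]\!]$. $\mathcal{L}$ is decomposable iff every consistent formula is decomposable or characteristic for some $p\in P$. -}

module Defs where

open import Data.Product using (Σ; ∃; ∃-syntax; _×_; _,_)
open import Data.Sum using (_⊎_)
open import Data.List using (List)
open import Data.List.Membership.Propositional using (_∈_)
open import Relation.Nullary using (¬_)
open import Function.Bundles using (_⇔_)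

-- A logic: a set P of processes, a set L of formulae and a semantic
-- function ⟦_⟧ : L → 𝒫(P), represented as a relation  sem φ p  ("p ∈ ⟦φ⟧").
module Logic {P L : Set} (sem : L → P → Set) where

  _≼_ : P → P → Set
  p ≼ q = ∀ φ → sem φ p → sem φ q

  FeaturesAnd : Set
  FeaturesAnd = ∀ φ ψ → ∃[ χ ] (∀ q → sem χ q ⇔ (sem φ q × sem ψ q))

  Consistent : L → Set
  Consistent φ = ∃[ p ] sem φ p

  Characteristic : L → P → Set
  Characteristic χ p = ∀ q → sem χ q ⇔ (p ≼ q)

  Finite : (L → Set) → Set
  Finite S = ∃[ xs ] (∀ ψ → S ψ ⇔ (ψ ∈ xs))

  CharacterizedBy : (P → L → Set) → Set
  CharacterizedBy B = ∀ p →
      (∃[ ψ ] B p ψ)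
    × (∀ ψ → B p ψ → sem ψ p)
    × (∀ φ → sem φ p → ∀ q → (∀ ψ → B p ψ → sem ψ q) → sem φ q)

  FinitelyCharacterizedBy : (P → L → Set) → Set
  FinitelyCharacterizedBy B = CharacterizedBy B × (∀ p → Finite (B p))

  Monotonic : (P → L → Set) → Set
  Monotonic B = ∀ p q → p ≼ q → ∀ ψ → B p ψ → B q ψ

  HasCoCharacteristic : Set
  HasCoCharacteristic = ∀ p χ → Characteristic χ p →
    ∃[ χ̄ ] ( (∀ q → sem χ̄ q ⇔ (¬ sem χ q))
           ⊎ ((¬ sem χ̄ p) × (∀ q → ¬ (q ≼ p) → sem χ̄ q)) )

  Decomposable : L → Set
  Decomposable φ = ∃[ p ] ∃[ χ ] (Characteristic χ p ×
    ∃[ ψ ] ((¬ sem ψ p) × (∀ q → sem φ q ⇔ (sem χ q ⊎ sem ψ q))))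

  LogicDecomposable : Set
  LogicDecomposable = ∀ φ → Consistent φ →
    Decomposable φ ⊎ (∃[ p ] Characteristic φ p)

{-# OPTIONS --safe #-}

-- Along a strictly ≼-descending sequence of processes the finite sets 𝓑(p)
-- strictly shrink (by monotonicity, and since 𝓑(p) ⊆ 𝓑(q) forces p ≼ q), so
-- every consistent φ has a ≼-minimal model p. The conjunction of 𝓑(p) is a
-- characteristic formula χ(p), and ψ_p := φ ∧ χ̄(p) misses p. A model q of φ
-- outside ⟦χ(p)⟧ is not above p, hence by minimality not below p either, and
-- both alternatives of (ii) put such a q into ⟦χ̄(p)⟧. Thus
-- ⟦φ⟧ = ⟦χ(p)⟧ ∪ ⟦ψ_p⟧: every consistent formula is in fact decomposable.

module Submission where

open import Defs
open import Level using (0ℓ)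
open import Axiom.ExcludedMiddle using (ExcludedMiddle)
open import Axiom.DoubleNegationElimination using (DoubleNegationElimination; em⇒dne)
open import Data.Product using (∃; ∃-syntax; _×_; _,_; proj₁; proj₂)
open import Data.List using (List; []; _∷_; length; foldr)
open import Data.List.Properties using (length-removeAt′)
open import Data.List.Relation.Unary.Any using (here; there; index)
open import Data.List.Relation.Unary.All using (All; []; _∷_; lookup; tabulate)
open import Data.List.Membership.Propositional using (_∈_; _─_)
open import Data.Nat using (suc; _≤_; _<_; s≤s)
open import Data.Nat.Properties using (n<1+n)
open import Data.Sum using (_⊎_; inj₁; inj₂)
open import Function.Bundles using (_⇔_; mk⇔; Equivalence)
open import Induction.WellFounded using (Acc; acc)
open import Relation.Nullary using (¬_; yes; no; contradiction)
open import Relation.Unary using (Pred; _⊆_; _⊂_)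
open import Relation.Binary.PropositionalEquality using (_≢_; refl; subst)
open Equivalence using (to; from)

∈-─⁺ : ∀ {A : Set} {x y : A} {xs} (x∈xs : x ∈ xs) → y ∈ xs → y ≢ x → y ∈ xs ─ x∈xs
∈-─⁺ (here refl) (here refl)  y≢x = contradiction refl y≢x
∈-─⁺ (here refl) (there y∈xs) _   = y∈xs
∈-─⁺ (there _)   (here refl)  _   = here refl
∈-─⁺ (there x∈xs) (there y∈xs) y≢x = there (∈-─⁺ x∈xs y∈xs y≢x)

module Classical (dne : DoubleNegationElimination 0ℓ) where

  ⊈-witness : ∀ {A : Set} {S T : Pred A 0ℓ} → ¬ (S ⊆ T) → ∃[ x ] (S x × ¬ T x)
  ⊈-witness S⊈T = dne λ none → S⊈T λ {x} Sx → dne λ ¬Tx → none (x , Sx , ¬Tx)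

  ⊂-accessible : ∀ {A : Set} {S : Pred A 0ℓ} (xs : List A) → S ⊆ (_∈ xs) → Acc _⊂_ S
  ⊂-accessible xs = bounded xs (n<1+n (length xs))
    where
    -- Each strict descent removes one element from the enumerating list.
    bounded : ∀ {A : Set} {n} {S : Pred A 0ℓ} (xs : List A) →
              length xs < n → S ⊆ (_∈ xs) → Acc _⊂_ S
    bounded {n = suc n} xs (s≤s |xs|≤n) S⊆xs = acc λ { {T} (T⊆S , S⊈T) →
      let (x , Sx , ¬Tx) = ⊈-witness S⊈T
          x∈xs           = S⊆xs Sx
      in bounded (xs ─ x∈xs)
                 (subst (_≤ n) (length-removeAt′ xs (index x∈xs)) |xs|≤n)
                 (λ Ty → ∈-─⁺ x∈xs (S⊆xs (T⊆S Ty)) λ { refl → ¬Tx Ty }) }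

module _ {P L : Set} {sem : L → P → Set} where
  open Logic sem

  ≼-refl : ∀ {p} → p ≼ p
  ≼-refl _ sφ = sφ

  Minimal : L → P → Set
  Minimal φ p = sem φ p × (∀ q → sem φ q → q ≼ p → p ≼ q)

  Separating : L → P → Set
  Separating χ̄ p = ¬ sem χ̄ p × (∀ q → ¬ p ≼ q → ¬ q ≼ p → sem χ̄ q)

  coCharacteristic⇒separating : ∀ {χ χ̄ p} → Characteristic χ p →
    (∀ q → sem χ̄ q ⇔ (¬ sem χ q)) ⊎ (¬ sem χ̄ p × (∀ q → ¬ q ≼ p → sem χ̄ q)) →
    Separating χ̄ p
  coCharacteristic⇒separating {p = p} χ-char (inj₁ χ̄-complement) =
      (λ sχ̄p → to (χ̄-complement p) sχ̄p (from (χ-char p) ≼-refl))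
    , λ q p⋠q _ → from (χ̄-complement q) λ sχq → p⋠q (to (χ-char q) sχq)
  coCharacteristic⇒separating _ (inj₂ (¬sχ̄p , χ̄-covers)) =
    ¬sχ̄p , λ q _ q⋠p → χ̄-covers q q⋠p

  module Conjunction (and : FeaturesAnd) where

    _∧_ : L → L → L
    φ ∧ ψ = proj₁ (and φ ψ)

    ∧-sem : ∀ φ ψ q → sem (φ ∧ ψ) q ⇔ (sem φ q × sem ψ q)
    ∧-sem φ ψ = proj₂ (and φ ψ)

    ⋀ : L → List L → L
    ⋀ = foldr _∧_

    ⋀⇒All : ∀ φ ψs {q} → sem (⋀ φ ψs) q → All (λ ψ → sem ψ q) ψs
    ⋀⇒All φ []       _ = []
    ⋀⇒All φ (ψ ∷ ψs) s = let (sψ , sψs) = to (∧-sem ψ (⋀ φ ψs) _) s in sψ ∷ ⋀⇒All φ ψs sψs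

    All⇒⋀ : ∀ φ ψs {q} → sem φ q → All (λ ψ → sem ψ q) ψs → sem (⋀ φ ψs) q
    All⇒⋀ φ []       sφ []          = sφ
    All⇒⋀ φ (ψ ∷ ψs) sφ (sψ ∷ sψs) = from (∧-sem ψ (⋀ φ ψs) _) (sψ , All⇒⋀ φ ψs sφ sψs)

    finitelyCharacterized⇒characteristic : ∀ {B} → FinitelyCharacterizedBy B →
      ∀ p → ∃[ χ ] Characteristic χ p
    finitelyCharacterized⇒characteristic (char , finite) p with char p | finite p
    ... | (ψ₀ , Bψ₀) , B⊆𝓛 , B-determines | ψs , ψs-enumerates =
      ⋀ ψ₀ ψs , λ q → mk⇔ (above q) (satisfies q)
      where
      above : ∀ q → sem (⋀ ψ₀ ψs) q → p ≼ q
      above q s φ sφp = B-determines φ sφp q λ ψ Bψ →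
        lookup (⋀⇒All ψ₀ ψs s) (to (ψs-enumerates ψ) Bψ)
      satisfies : ∀ q → p ≼ q → sem (⋀ ψ₀ ψs) q
      satisfies q p≼q = All⇒⋀ ψ₀ ψs (p≼q ψ₀ (B⊆𝓛 ψ₀ Bψ₀))
        (tabulate λ {ψ} ψ∈ψs → p≼q ψ (B⊆𝓛 ψ (from (ψs-enumerates ψ) ψ∈ψs)))

  module Characterization {B : P → L → Set} (char : CharacterizedBy B) where

    ⊆⇒≼ : ∀ {p q} → B p ⊆ B q → p ≼ q
    ⊆⇒≼ {p} {q} Bp⊆Bq φ sφp =
      proj₂ (proj₂ (char p)) φ sφp q λ ψ Bpψ → proj₁ (proj₂ (char q)) ψ (Bp⊆Bq Bpψ)

    ≺⇒⊂ : Monotonic B → ∀ {p q} → q ≼ p → ¬ p ≼ q → B q ⊂ B p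
    ≺⇒⊂ mono q≼p p⋠q = (λ {ψ} → mono _ _ q≼p ψ) , λ Bp⊆Bq → p⋠q (⊆⇒≼ Bp⊆Bq)

  module _ (em : ExcludedMiddle 0ℓ) where
    open Classical (em⇒dne em)

    minimal-below : ∀ {B} → CharacterizedBy B → Monotonic B →
      ∀ {φ p} → sem φ p → Acc _⊂_ (B p) → ∃[ m ] Minimal φ m
    minimal-below char mono {φ} {p} sφp (acc descend)
      with em {∃[ q ] (sem φ q × q ≼ p × ¬ p ≼ q)}
    ... | yes (q , sφq , q≼p , p⋠q) =
      minimal-below char mono sφq (descend (Characterization.≺⇒⊂ char mono q≼p p⋠q))
    ... | no ∄q = p , sφp , λ q sφq q≼p → em⇒dne em λ p⋠q → ∄q (q , sφq , q≼p , p⋠q)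

    consistent⇒minimal : ∀ {B} → FinitelyCharacterizedBy B → Monotonic B →
      ∀ {φ} → Consistent φ → ∃[ m ] Minimal φ m
    consistent⇒minimal (char , finite) mono (p , sφp) =
      minimal-below char mono sφp (⊂-accessible (proj₁ (finite p)) λ {ψ} → to (proj₂ (finite p) ψ))

    minimal⇒decomposable : FeaturesAnd → ∀ {φ p χ χ̄} →
      Minimal φ p → Characteristic χ p → Separating χ̄ p → Decomposable φ
    minimal⇒decomposable and {φ} {p} {χ} {χ̄} (sφp , p-minimal) χ-char (¬sχ̄p , χ̄-separates) =
      p , χ , χ-char , φ ∧ χ̄ , (λ s → ¬sχ̄p (proj₂ (to (∧-sem φ χ̄ p) s)))
        , λ q → mk⇔ (split q) (join q)
      where
      open Conjunction and
      split : ∀ q → sem φ q → sem χ q ⊎ sem (φ ∧ χ̄) q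
      split q sφq with em {p ≼ q}
      ... | yes p≼q = inj₁ (from (χ-char q) p≼q)
      ... | no p⋠q  = inj₂ (from (∧-sem φ χ̄ q)
                        (sφq , χ̄-separates q p⋠q λ q≼p → p⋠q (p-minimal q sφq q≼p)))
      join : ∀ q → sem χ q ⊎ sem (φ ∧ χ̄) q → sem φ q
      join q (inj₁ sχq) = to (χ-char q) sχq φ sφp
      join q (inj₂ s)   = proj₁ (to (∧-sem φ χ̄ q) s)

mainTheorem15 : ExcludedMiddle 0ℓ →
    (P L : Set) (sem : L → P → Set) →
    P →
    (∀ p → ∃[ φ ] sem φ p) →
    Logic.FeaturesAnd sem →
    (∃[ B ] (Logic.FinitelyCharacterizedBy sem B × Logic.Monotonic sem B)) →
    Logic.HasCoCharacteristic sem →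
    Logic.LogicDecomposable sem
mainTheorem15 em _ _ _ _ _ and (B , finChar , mono) coChar φ φ-consistent =
  let (p , p-minimal) = consistent⇒minimal em finChar mono φ-consistent
      (χ , χ-char)    = Conjunction.finitelyCharacterized⇒characteristic and finChar p
      (χ̄ , χ̄-co)      = coChar p χ χ-char
  in inj₁ (minimal⇒decomposable em and p-minimal χ-char (coCharacteristic⇒separating χ-char χ̄-co))
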